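{- Let $\mathcal L$ be an SG-LCS with induced game $\mathcal G$, let $x\in\{0,1\}$, and let $Q$ be a regular set of configurations that is a $(1-x)$-trap. Then there exists a regular SG-LCS strategy $\mathtt f$ for Player $x$ such that for every $s\in Q$ and every strategy $g$ of Player $1-x$, every run from $s$ consistent with $\hat{\mathtt f}$ and $g$ stays in $Q$ forever.
   Context: An SG-LCS is a tuple $\mathcal L=(\mathtt S,\mathtt S^0,\mathtt S^1,\mathtt C,\mathtt M,\mathtt T,\lambda,\mathrm{Col})$: finite control states $\mathtt S=\mathtt S^0\uplus\mathtt S^1$; finite channels $\mathtt C$; finite alphabet $\mathtt M$; finite set $\mathtt T$ of transitions $\mathtt s\xrightarrow{op}\mathtt s'$, $op\in\{c!m,c?m,\mathrm{nop}\}$; loss rate $0<\lambda<1$; coloring $\mathrm{Col}$. Induced game: configurations $S=\mathtt S\times(\mathtt M^*)^{\mathtt C}\times\{0,1\}$; Player-$y$ configurations $S^y=\mathtt S^y\times(\mathtt M^*)^{\mathtt C}\times\{1\}$; random configurations $S^R$ are those with bit 0. $(\mathtt s,\mathbf x,1)\to(\mathtt s',\mathbf x',0)$ iff some $\mathtt s\xrightarrow{op}\mathtt s'\in\mathtt T$ has $op=\mathrm{nop}$, $\mathbf x'=\mathbf x$, or $op=c!m$, $\mathbf x'=\mathbf x[c\mapsto\mathbf x(c)m]$, or $op=c?m$, $\mathbf x(c)=mw$, $\mathbf x'=\mathbf x[c\mapsto w]$; if none applies, $(\mathtt s,\mathbf x,1)\to(\mathtt s,\mathbf x,0)$; $(\mathtt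 s,\mathbf x,0)\to(\mathtt s,\mathbf x',1)$ for every $\mathbf x'$ obtained from $\mathbf x$ by deleting messages (each lost independently with probability $\lambda$). A strategy of Player $y$ is a partial function from finite paths ending in $S^y$ to successors of the last configuration; a run is consistent with it if it follows its value whenever defined. $Q$ is closable if every configuration of $Q$ has a successor in $Q$ and all successors of configurations in $Q\cap S^R$ lie in $Q$; a $y$-trap if closable and all successors of configurations in $Q\cap S^y$ lie in $Q$. Regular sets: for each control state and bit, the set of channel contents is a finite union of products $\prod_c L_c$ of regular $L_c\subseteq\mathtt M^*$. A regular SG-LCS strategy $\mathtt f$ for Player $x$ is a finite list of guarded rules $(\mathtt s_i,X_i\xrightarrow{op_i}\mathtt s_i')$, $X_i$ regular sets of channel contents, $\mathtt s_i\xrightarrow{op_i}\mathtt s_i'\in\mathtt T$, $\mathtt s_i\in\mathtt S^x$, with receive rules $c?m$ requiring $m$ first in $\mathbf x(c)$ for all $\mathbf x\in X_i$, and disjoint guards for rules with the same control state; its induced memoryless strategy $\hat{\mathtt f}$ maps $(\mathtt s,\mathbf x,1)$ with $\mathbf x\in X_i$, $\mathtt s_i=\mathtt s$, to the successor obtained via rule $i$'s transition, and is undefined elsewhere.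
   Formalization: The loss rate $\lambda$ is taken in the rationals. -}

module Defs where

open import Data.Nat using (ℕ; zero; suc)
open import Data.Fin using (Fin)
open import Data.Bool using (Bool; true; false)
open import Data.List using (List; []; _∷_; _++_; [_]; foldl; map; upTo)
open import Data.List.Membership.Propositional using (_∈_)
open import Data.List.Relation.Unary.Any using (Any)
open import Data.List.Relation.Binary.Sublist.Propositional using (_⊆_)
open import Data.Vec using (Vec; lookup; _[_]≔_)
open import Data.Maybe using (Maybe; just; nothing)
open import Data.Product using (Σ; ∃; _×_; _,_)
open import Data.Empty using (⊥)
open import Data.Rational using (ℚ; 0ℚ; 1ℚ; _<_)
open import Relation.Nullary using (¬_)
open import Relation.Binary.PropositionalEquality using (_≡_; _≢_)

data Player : Set where
  P0 P1 : Player

opp : Player → Player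
opp P0 = P1
opp P1 = P0

data Op (nC nM : ℕ) : Set where
  nop  : Op nC nM
  send : Fin nC → Fin nM → Op nC nM
  recv : Fin nC → Fin nM → Op nC nM

record Trans (nS nC nM : ℕ) : Set where
  constructor mkTrans
  field
    src : Fin nS
    op  : Op nC nM
    tgt : Fin nS
open Trans public

record DFA (k : ℕ) : Set where
  field
    size  : ℕ
    δ     : Fin size → Fin k → Fin size
    start : Fin size
    final : Fin size → Bool

accepts : ∀ {k} → DFA k → List (Fin k) → Bool
accepts A w = DFA.final A (foldl (DFA.δ A) (DFA.start A) w)

Contents : ℕ → ℕ → Set
Contents nC nM = Vec (List (Fin nM)) nC

-- a regular set of channel contents: finite union of products ∏_c L_c
RegContents : ℕ → ℕ → Set
RegContents nC nM = List (Fin nC → DFA nM)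

_∈RC_ : ∀ {nC nM} → Contents nC nM → RegContents nC nM → Set
xs ∈RC R = Any (λ P → ∀ c → accepts (P c) (lookup xs c) ≡ true) R

record SGLCS : Set where
  field
    nS nC nM : ℕ
    owner    : Fin nS → Player
    T        : List (Trans nS nC nM)
    lossRate : ℚ
    lossPos  : 0ℚ < lossRate
    lossLt1  : lossRate < 1ℚ
    Col      : Fin nS → ℕ

module _ (L : SGLCS) where
  open SGLCS L

  -- configurations (s, x, bit); bit true = 1, false = 0 (random)
  record Config : Set where
    constructor ⟨_,_,_⟩
    field
      st  : Fin nS
      ch  : Contents nC nM
      bit : Bool

  Effect : Op nC nM → Contents nC nM → Contents nC nM → Set
  Effect nop        xs xs' = xs' ≡ xs
  Effect (send c m) xs xs' = xs' ≡ (xs [ c ]≔ (lookup xs c ++ [ m ]))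
  Effect (recv c m) xs xs' = ∃ λ w → (lookup xs c ≡ m ∷ w) × (xs' ≡ (xs [ c ]≔ w))

  data Step : Config → Config → Set where
    move  : ∀ {t xs xs'} → t ∈ T → Effect (op t) xs xs' →
            Step ⟨ src t , xs , true ⟩ ⟨ tgt t , xs' , false ⟩
    stuck : ∀ {s xs} →
            ¬ (Σ (Trans nS nC nM) λ t → t ∈ T × src t ≡ s × ∃ λ xs' → Effect (op t) xs xs') →
            Step ⟨ s , xs , true ⟩ ⟨ s , xs , false ⟩
    lose  : ∀ {s xs xs'} → (∀ c → lookup xs' c ⊆ lookup xs c) →
            Step ⟨ s , xs , false ⟩ ⟨ s , xs' , true ⟩

  OwnedBy : Player → Config → Set
  OwnedBy y c = (Config.bit c ≡ true) × (owner (Config.st c) ≡ y)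

  Random : Config → Set
  Random c = Config.bit c ≡ false

  Closable : (Config → Set) → Set
  Closable Q = (∀ c → Q c → ∃ λ c' → Step c c' × Q c')
             × (∀ c c' → Q c → Random c → Step c c' → Q c')

  Trap : Player → (Config → Set) → Set
  Trap y Q = Closable Q × (∀ c c' → Q c → OwnedBy y c → Step c c' → Q c')

  RegConfRep : Set
  RegConfRep = Fin nS → Bool → RegContents nC nM

  IsRegular : (Config → Set) → Set
  IsRegular Q = Σ RegConfRep λ R → ∀ c →
    (Q c → Config.ch c ∈RC R (Config.st c) (Config.bit c)) ×
    (Config.ch c ∈RC R (Config.st c) (Config.bit c) → Q c)

  -- general (history-dependent, partial) strategies of Player y.
  -- move h c: value on the finite path h ++ [ c ] (h = earlier configurations)
  record Strategy (y : Player) : Set where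
    field
      choose : List Config → Config → Maybe Config
      sound  : ∀ h c c' → choose h c ≡ just c' → Step c c'

  record Run (s : Config) : Set where
    field
      ρ     : ℕ → Config
      start : ρ zero ≡ s
      steps : ∀ i → Step (ρ i) (ρ (suc i))

  prefix : (ℕ → Config) → ℕ → List Config
  prefix ρ i = map ρ (upTo i)

  ConsistentWith : ∀ {s} (y : Player) → Strategy y → Run s → Set
  ConsistentWith y g r = ∀ i c' → OwnedBy y (Run.ρ r i) →
    Strategy.choose g (prefix (Run.ρ r) i) (Run.ρ r i) ≡ just c' →
    Run.ρ r (suc i) ≡ c'

  record Rule : Set where
    field
      state   : Fin nS
      guard   : RegContents nC nM
      trans   : Trans nS nC nM
      trans∈T : trans ∈ T
      srcOK   : src trans ≡ state

  record RegStrategy (x : Player) : Set where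
    field
      k        : ℕ
      rule     : Fin k → Rule
      owned    : ∀ i → owner (Rule.state (rule i)) ≡ x
      recvOK   : ∀ i c m → op (Rule.trans (rule i)) ≡ recv c m →
                 ∀ xs → xs ∈RC Rule.guard (rule i) → ∃ λ w → lookup xs c ≡ m ∷ w
      disjoint : ∀ i j → i ≢ j → Rule.state (rule i) ≡ Rule.state (rule j) →
                 ∀ xs → xs ∈RC Rule.guard (rule i) → xs ∈RC Rule.guard (rule j) → ⊥

  -- graph of the induced memoryless strategy f̂ (functional by disjointness)
  FHat : ∀ {x} → RegStrategy x → Config → Config → Set
  FHat f c c' = Σ (Fin (RegStrategy.k f)) λ i →
    let r = RegStrategy.rule f i in
    (Config.st c ≡ Rule.state r) × (Config.bit c ≡ true) ×
    (Config.ch c ∈RC Rule.guard r) ×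
    (∃ λ xs' → Effect (op (Rule.trans r)) (Config.ch c) xs' ×
               (c' ≡ ⟨ tgt (Rule.trans r) , xs' , false ⟩))

  ConsistentWithHat : ∀ {s} (x : Player) → RegStrategy x → Run s → Set
  ConsistentWithHat x f r = ∀ i c' → OwnedBy x (Run.ρ r i) →
    FHat f (Run.ρ r i) c' → Run.ρ r (suc i) ≡ c'

module Submission where

-- For a transition t write Enabled t for the
-- regular set of channel contents from which t leads into Q (the preimage
-- under op t of Q's description at the random copy of tgt t).  Player x plays
-- the transitions that are enabled in this sense; to make the guards of rules
-- with the same control state disjoint, the guard of t additionally excludes
-- the contents already enabled for a later x-transition with the same source.
-- From a configuration of Q a successor in Q exists (Q is closable); if it is
-- reached by a move then some rule fires, and the resulting move stays in Q.
-- Random and (1-x)-moves stay in Q because Q is a (1-x)-trap.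

open import Defs
open import Data.Nat using (ℕ; zero; suc; _*_; _+_)
open import Data.Fin using (Fin; zero; suc; combine; remQuot) renaming (_≟_ to _≟ᶠ_)
open import Data.Fin.Properties using (remQuot-combine; all?; ¬∀⟶∃¬)
open import Data.Bool using (Bool; true; false; not; _∧_; if_then_else_)
open import Data.Bool.Properties using (∧-conicalˡ; ∧-conicalʳ; not-¬; ¬-not) renaming (_≟_ to _≟ᵇ_)
open import Data.List using (List; []; _∷_; _++_; [_]; foldl; foldr; map; allFin; cartesianProductWith; concatMap; filter)
import Data.List as List
open import Data.List.Properties using (foldl-++)
open import Data.List.Relation.Unary.Any using (Any; here; there; any?)
import Data.List.Relation.Unary.Any as Any
open import Data.List.Relation.Unary.Any.Properties using (map⁺; map⁻; cartesianProductWith⁺; cartesianProductWith⁻; concatMap⁺; concatMap⁻; lookup-index)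
open import Data.List.Relation.Unary.All using (All; []; _∷_)
import Data.List.Relation.Unary.All as All
open import Data.List.Relation.Unary.AllPairs using (AllPairs; []; _∷_)
open import Data.List.Membership.Propositional using (_∈_; find)
open import Data.List.Relation.Binary.Subset.Propositional using (_⊆_)
open import Data.List.Membership.Propositional.Properties using (∈-allFin; ∈-lookup; ∈-filter⁺; ∈-filter⁻)
open import Data.Vec using (lookup; _[_]≔_)
open import Data.Vec.Properties using (lookup∘update; lookup∘update′)
open import Data.Vec.Functional using (updateAt)
open import Data.Vec.Functional.Properties using (updateAt-updates; updateAt-minimal)
open import Data.Product using (Σ; ∃; _×_; _,_; proj₁; proj₂)
open import Data.Sum using (_⊎_; inj₁; inj₂)
open import Data.Empty using (⊥; ⊥-elim)
open import Relation.Nullary using (¬_; Dec; yes; no; does)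
open import Relation.Binary.PropositionalEquality using (_≡_; _≢_; refl; sym; trans; cong; cong₂; subst; module ≡-Reasoning)

_≟ᴾ_ : (p q : Player) → Dec (p ≡ q)
P0 ≟ᴾ P0 = yes refl
P0 ≟ᴾ P1 = no λ ()
P1 ≟ᴾ P0 = no λ ()
P1 ≟ᴾ P1 = yes refl

player-dichotomy : ∀ p x → p ≡ x ⊎ p ≡ opp x
player-dichotomy P0 P0 = inj₁ refl
player-dichotomy P0 P1 = inj₂ refl
player-dichotomy P1 P0 = inj₂ refl
player-dichotomy P1 P1 = inj₁ refl

module WordLanguages {k : ℕ} where

  universal : DFA k
  universal = record { size = 1 ; δ = λ q _ → q ; start = zero ; final = λ _ → true }

  complement : DFA k → DFA k
  complement A = record A { final = λ q → not (DFA.final A q) }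

  complement-accepts⁺ : ∀ A w → accepts A w ≢ true → accepts (complement A) w ≡ true
  complement-accepts⁺ A w rejected = cong not (¬-not rejected)

  complement-accepts⁻ : ∀ A w → accepts (complement A) w ≡ true → accepts A w ≢ true
  complement-accepts⁻ A w acc accepted = not-¬ (sym accepted) (sym acc)

  module _ (A B : DFA k) where
    pairStep : Fin (DFA.size A) × Fin (DFA.size B) → Fin k → Fin (DFA.size A * DFA.size B)
    pairStep (p , q) a = combine (DFA.δ A p a) (DFA.δ B q a)

    pairFinal : Fin (DFA.size A) × Fin (DFA.size B) → Bool
    pairFinal (p , q) = DFA.final A p ∧ DFA.final B q

  intersection : DFA k → DFA k → DFA k
  intersection A B = record
    { size  = DFA.size A * DFA.size B
    ; δ     = λ pq → pairStep A B (remQuot (DFA.size B) pq)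
    ; start = combine (DFA.start A) (DFA.start B)
    ; final = λ pq → pairFinal A B (remQuot (DFA.size B) pq)
    }

  intersection-run : ∀ A B p q w →
    foldl (DFA.δ (intersection A B)) (combine p q) w ≡ combine (foldl (DFA.δ A) p w) (foldl (DFA.δ B) q w)
  intersection-run A B p q []      = refl
  intersection-run A B p q (a ∷ w) =
    trans (cong (λ pq → foldl (DFA.δ (intersection A B)) (pairStep A B pq a) w) (remQuot-combine p q))
          (intersection-run A B (DFA.δ A p a) (DFA.δ B q a) w)

  intersection-accepts : ∀ A B w → accepts (intersection A B) w ≡ (accepts A w ∧ accepts B w)
  intersection-accepts A B w =
    trans (cong (DFA.final (intersection A B)) (intersection-run A B (DFA.start A) (DFA.start B) w))
          (cong (pairFinal A B) (remQuot-combine _ _))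

  rightQuotient : DFA k → Fin k → DFA k
  rightQuotient A m = record A { final = λ q → DFA.final A (DFA.δ A q m) }

  rightQuotient-accepts : ∀ A m w → accepts (rightQuotient A m) w ≡ accepts A (w ++ [ m ])
  rightQuotient-accepts A m w = cong (DFA.final A) (sym (foldl-++ (DFA.δ A) (DFA.start A) w [ m ]))

  -- the language m · L(A); state 0 is initial, state 1 a rejecting sink, and
  -- the remaining states are a copy of A
  prefixed : Fin k → DFA k → DFA k
  prefixed m A = record { size = 2 + DFA.size A ; δ = step ; start = zero ; final = accepting }
    where
    step : Fin (2 + DFA.size A) → Fin k → Fin (2 + DFA.size A)
    step zero           a = if does (a ≟ᶠ m) then suc (suc (DFA.start A)) else suc zero
    step (suc zero)     _ = suc zero
    step (suc (suc q))  a = suc (suc (DFA.δ A q a))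
    accepting : Fin (2 + DFA.size A) → Bool
    accepting zero          = false
    accepting (suc zero)    = false
    accepting (suc (suc q)) = DFA.final A q

  prefixed-sink : ∀ m A w → foldl (DFA.δ (prefixed m A)) (suc zero) w ≡ suc zero
  prefixed-sink m A []      = refl
  prefixed-sink m A (_ ∷ w) = prefixed-sink m A w

  prefixed-copy : ∀ m A q w → foldl (DFA.δ (prefixed m A)) (suc (suc q)) w ≡ suc (suc (foldl (DFA.δ A) q w))
  prefixed-copy m A q []      = refl
  prefixed-copy m A q (a ∷ w) = prefixed-copy m A (DFA.δ A q a) w

  prefixed-accepts : ∀ m A w → accepts (prefixed m A) (m ∷ w) ≡ accepts A w
  prefixed-accepts m A w with m ≟ᶠ m
  ... | yes _  = cong (DFA.final (prefixed m A)) (prefixed-copy m A (DFA.start A) w)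
  ... | no m≢m = ⊥-elim (m≢m refl)

  prefixed-head : ∀ m A w → accepts (prefixed m A) w ≡ true → ∃ λ v → w ≡ m ∷ v
  prefixed-head m A []      ()
  prefixed-head m A (a ∷ v) acc with a ≟ᶠ m
  ... | yes refl = v , refl
  ... | no _ with trans (sym (cong (DFA.final (prefixed m A)) (prefixed-sink m A v))) acc
  ...   | ()

module RegularContents {nC nM : ℕ} where
  open WordLanguages

  Product : Set
  Product = Fin nC → DFA nM

  _∈ₚ_ : Contents nC nM → Product → Set
  xs ∈ₚ P = ∀ c → accepts (P c) (lookup xs c) ≡ true

  _∈ₚ?_ : ∀ xs P → Dec (xs ∈ₚ P)
  xs ∈ₚ? P = all? (λ c → accepts (P c) (lookup xs c) ≟ᵇ true)

  _∈?_ : ∀ xs (A : RegContents nC nM) → Dec (xs ∈RC A)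
  xs ∈? A = any? (xs ∈ₚ?_) A

  everything : RegContents nC nM
  everything = [ (λ _ → universal) ]

  ∈-everything : ∀ xs → xs ∈RC everything
  ∈-everything xs = here (λ _ → refl)

  _∩ₚ_ : Product → Product → Product
  (P ∩ₚ P′) c = intersection (P c) (P′ c)

  ∈-∩ₚ⁺ : ∀ xs P P′ → xs ∈ₚ P → xs ∈ₚ P′ → xs ∈ₚ (P ∩ₚ P′)
  ∈-∩ₚ⁺ xs P P′ h h′ c = trans (intersection-accepts (P c) (P′ c) (lookup xs c)) (cong₂ _∧_ (h c) (h′ c))

  ∈-∩ₚ⁻ : ∀ xs P P′ → xs ∈ₚ (P ∩ₚ P′) → xs ∈ₚ P × xs ∈ₚ P′
  ∈-∩ₚ⁻ xs P P′ h =
    (λ c → ∧-conicalˡ _ _ (both c)) , (λ c → ∧-conicalʳ _ _ (both c))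
    where
    both : ∀ c → (accepts (P c) (lookup xs c) ∧ accepts (P′ c) (lookup xs c)) ≡ true
    both c = trans (sym (intersection-accepts (P c) (P′ c) (lookup xs c))) (h c)

  _∩_ : RegContents nC nM → RegContents nC nM → RegContents nC nM
  A ∩ B = cartesianProductWith _∩ₚ_ A B

  ∈-∩⁺ : ∀ xs {A B} → xs ∈RC A → xs ∈RC B → xs ∈RC (A ∩ B)
  ∈-∩⁺ xs = cartesianProductWith⁺ _∩ₚ_ (λ {P} {P′} → ∈-∩ₚ⁺ xs P P′)

  ∈-∩⁻ : ∀ xs A B → xs ∈RC (A ∩ B) → xs ∈RC A × xs ∈RC B
  ∈-∩⁻ xs = cartesianProductWith⁻ _∩ₚ_ (λ {P} {P′} → ∈-∩ₚ⁻ xs P P′)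

  outsideAt : Product → Fin nC → Product
  outsideAt P c = updateAt (λ _ → universal) c (λ _ → complement (P c))

  ∁ₚ : Product → RegContents nC nM
  ∁ₚ P = map (outsideAt P) (allFin nC)

  ∈-∁ₚ⁺ : ∀ xs P → ¬ xs ∈ₚ P → xs ∈RC ∁ₚ P
  ∈-∁ₚ⁺ xs P xs∉P with ¬∀⟶∃¬ nC _ (λ c → accepts (P c) (lookup xs c) ≟ᵇ true) xs∉P
  ... | c , rejected = map⁺ (Any.map (λ { refl → outside }) (∈-allFin c))
    where
    outside : xs ∈ₚ outsideAt P c
    outside c′ with c′ ≟ᶠ c
    ... | yes refl = trans (cong (λ A → accepts A (lookup xs c)) (updateAt-updates c _))
                           (complement-accepts⁺ (P c) (lookup xs c) rejected)
    ... | no c′≢c  = cong (λ A → accepts A (lookup xs c′)) (updateAt-minimal c′ c _ c′≢c)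

  ∈-∁ₚ⁻ : ∀ xs P → xs ∈RC ∁ₚ P → ¬ xs ∈ₚ P
  ∈-∁ₚ⁻ xs P h xs∈P with Any.satisfied (map⁻ h)
  ... | c , outside =
    complement-accepts⁻ (P c) (lookup xs c)
      (trans (sym (cong (λ A → accepts A (lookup xs c)) (updateAt-updates c _))) (outside c))
      (xs∈P c)

  ∁ : RegContents nC nM → RegContents nC nM
  ∁ = foldr (λ P C → ∁ₚ P ∩ C) everything

  ∈-∁⁺ : ∀ xs A → ¬ xs ∈RC A → xs ∈RC ∁ A
  ∈-∁⁺ xs []      _    = ∈-everything xs
  ∈-∁⁺ xs (P ∷ A) xs∉A = ∈-∩⁺ xs (∈-∁ₚ⁺ xs P (λ h → xs∉A (here h))) (∈-∁⁺ xs A (λ h → xs∉A (there h)))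

  ∈-∁⁻ : ∀ xs A → xs ∈RC ∁ A → ¬ xs ∈RC A
  ∈-∁⁻ xs (P ∷ A) h (here xs∈P)  = ∈-∁ₚ⁻ xs P (proj₁ (∈-∩⁻ xs (∁ₚ P) (∁ A) h)) xs∈P
  ∈-∁⁻ xs (P ∷ A) h (there xs∈A) = ∈-∁⁻ xs A (proj₂ (∈-∩⁻ xs (∁ₚ P) (∁ A) h)) xs∈A

  updateAt-agrees : ∀ P c (f : DFA nM → DFA nM) (xs : Contents nC nM) v →
    accepts (f (P c)) (lookup xs c) ≡ accepts (P c) v →
    ∀ c′ → accepts (updateAt P c f c′) (lookup xs c′) ≡ accepts (P c′) (lookup (xs [ c ]≔ v) c′)
  updateAt-agrees P c f xs v agree c′ with c′ ≟ᶠ c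
  ... | yes refl = begin
    accepts (updateAt P c f c) (lookup xs c) ≡⟨ cong (λ A → accepts A (lookup xs c)) (updateAt-updates c P) ⟩
    accepts (f (P c)) (lookup xs c)          ≡⟨ agree ⟩
    accepts (P c) v                          ≡⟨ cong (accepts (P c)) (sym (lookup∘update c xs v)) ⟩
    accepts (P c) (lookup (xs [ c ]≔ v) c)   ∎
    where open ≡-Reasoning
  ... | no c′≢c = trans (cong (λ A → accepts A (lookup xs c′)) (updateAt-minimal c′ c P c′≢c))
                        (cong (accepts (P c′)) (sym (lookup∘update′ c′≢c xs v)))

module Preimage (L : SGLCS) where
  open SGLCS L using (nC; nM)
  open WordLanguages
  open RegularContents

  -- a product describing the contents whose image under o lies in P: sending m
  -- on c quotients L(P c) by m on the right, receiving m prefixes it with m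
  preₚ : Op nC nM → Product → Product
  preₚ nop        P = P
  preₚ (send c m) P = updateAt P c (λ A → rightQuotient A m)
  preₚ (recv c m) P = updateAt P c (prefixed m)

  preₚ-agrees : ∀ o P {xs xs′} → Effect L o xs xs′ →
    ∀ c → accepts (preₚ o P c) (lookup xs c) ≡ accepts (P c) (lookup xs′ c)
  preₚ-agrees nop        P refl = λ _ → refl
  preₚ-agrees (send c m) P {xs} refl =
    updateAt-agrees P c _ xs _ (rightQuotient-accepts (P c) m (lookup xs c))
  preₚ-agrees (recv c m) P {xs} (w , head≡m , refl) =
    updateAt-agrees P c _ xs w (trans (cong (accepts (prefixed m (P c))) head≡m) (prefixed-accepts m (P c) w))

  preimage : Op nC nM → RegContents nC nM → RegContents nC nM
  preimage o = map (preₚ o)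

  ∈-preimage⁺ : ∀ {o A} xs {xs′} → Effect L o xs xs′ → xs′ ∈RC A → xs ∈RC preimage o A
  ∈-preimage⁺ {o} xs e h = map⁺ (Any.map (λ {P} xs′∈P c → trans (preₚ-agrees o P e c) (xs′∈P c)) h)

  ∈-preimage⁻ : ∀ {o A} xs {xs′} → Effect L o xs xs′ → xs ∈RC preimage o A → xs′ ∈RC A
  ∈-preimage⁻ {o} xs e h = Any.map (λ {P} xs∈P c → trans (sym (preₚ-agrees o P e c)) (xs∈P c)) (map⁻ h)

  ∈-preimage-recv : ∀ {c m A} xs → xs ∈RC preimage (recv c m) A → ∃ λ w → lookup xs c ≡ m ∷ w
  ∈-preimage-recv {c} {m} xs h with Any.satisfied (map⁻ h)
  ... | P , xs∈P = prefixed-head m (P c) (lookup xs c)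
    (trans (sym (cong (λ B → accepts B (lookup xs c)) (updateAt-updates c P))) (xs∈P c))

  ∈-preimage-effect : ∀ {o A} xs → xs ∈RC preimage o A → ∃ λ xs′ → Effect L o xs xs′ × xs′ ∈RC A
  ∈-preimage-effect {nop}      xs h = xs , refl , ∈-preimage⁻ {nop} xs refl h
  ∈-preimage-effect {send c m} xs h = _ , refl , ∈-preimage⁻ {send c m} xs refl h
  ∈-preimage-effect {recv c m} xs h with ∈-preimage-recv xs h
  ... | w , head≡m = _ , (w , head≡m , refl) , ∈-preimage⁻ xs (w , head≡m , refl) h

allPairs-lookup : ∀ {A : Set} {R : A → A → Set} → (∀ {a b} → R a b → R b a) →
  ∀ {as} → AllPairs R as → ∀ i j → i ≢ j → R (List.lookup as i) (List.lookup as j)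
allPairs-lookup R-sym (_ ∷ _)   zero    zero    0≢0 = ⊥-elim (0≢0 refl)
allPairs-lookup R-sym (a~ ∷ _)  zero    (suc j) _   = All.lookup a~ (∈-lookup j)
allPairs-lookup R-sym (a~ ∷ _)  (suc i) zero    _   = R-sym (All.lookup a~ (∈-lookup i))
allPairs-lookup R-sym (_ ∷ as~) (suc i) (suc j) i≢j = allPairs-lookup R-sym as~ i j (λ i≡j → i≢j (cong suc i≡j))

module RuleLists (L : SGLCS) where
  open SGLCS L using (owner)

  ReceiveSafe : Rule L → Set
  ReceiveSafe r = ∀ c m → op (Rule.trans r) ≡ recv c m →
                  ∀ xs → xs ∈RC Rule.guard r → ∃ λ w → lookup xs c ≡ m ∷ w

  Disjoint : Rule L → Rule L → Set
  Disjoint r r′ = Rule.state r ≡ Rule.state r′ →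
                  ∀ xs → xs ∈RC Rule.guard r → xs ∈RC Rule.guard r′ → ⊥

  disjoint-sym : ∀ {r r′} → Disjoint r r′ → Disjoint r′ r
  disjoint-sym disjoint same xs h h′ = disjoint (sym same) xs h′ h

  toRegStrategy : ∀ x (rs : List (Rule L)) →
    All (λ r → owner (Rule.state r) ≡ x × ReceiveSafe r) rs → AllPairs Disjoint rs → RegStrategy L x
  toRegStrategy x rs wellFormed disjoint = record
    { k        = List.length rs
    ; rule     = List.lookup rs
    ; owned    = λ i → proj₁ (All.lookup wellFormed (∈-lookup i))
    ; recvOK   = λ i → proj₂ (All.lookup wellFormed (∈-lookup i))
    ; disjoint = allPairs-lookup (λ {r} {r′} → disjoint-sym {r} {r′}) disjoint
    }

-- Prioritised rules for a family of guards `Enabled t`: the rule for t fires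
-- where t is enabled, unless a later transition of the list with the same
-- source is enabled too.
module Prioritised (L : SGLCS) (Enabled : Trans (SGLCS.nS L) (SGLCS.nC L) (SGLCS.nM L) → RegContents (SGLCS.nC L) (SGLCS.nM L)) where
  open SGLCS L using (nS; nC; nM; T)
  open RegularContents
  open RuleLists L using (Disjoint)

  Tr : Set
  Tr = Trans nS nC nM

  Claimed : List Tr → Fin nS → RegContents nC nM
  Claimed ts s = concatMap Enabled (filter (λ t → src t ≟ᶠ s) ts)

  claimed⁺ : ∀ xs {t ts s} → t ∈ ts → src t ≡ s → xs ∈RC Enabled t → xs ∈RC Claimed ts s
  claimed⁺ xs {s = s} t∈ts src≡s h =
    concatMap⁺ Enabled (Any.map (λ { refl → h }) (∈-filter⁺ (λ t → src t ≟ᶠ s) t∈ts src≡s))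

  claimed⁻ : ∀ xs {ts s} → xs ∈RC Claimed ts s → ∃ λ t → t ∈ ts × src t ≡ s × xs ∈RC Enabled t
  claimed⁻ xs {s = s} h with find (concatMap⁻ Enabled h)
  ... | t , t∈filter , xs∈t with ∈-filter⁻ (λ t → src t ≟ᶠ s) t∈filter
  ...   | t∈ts , src≡s = t , t∈ts , src≡s , xs∈t

  priorityGuard : Tr → List Tr → RegContents nC nM
  priorityGuard t later = Enabled t ∩ ∁ (Claimed later (src t))

  drop⊆ : ∀ {t ts} → t ∷ ts ⊆ T → ts ⊆ T
  drop⊆ t∷ts⊆T t′∈ts = t∷ts⊆T (there t′∈ts)

  priorityRule : (t : Tr) → t ∈ T → List Tr → Rule L
  priorityRule t t∈T later =
    record { state = src t ; guard = priorityGuard t later ; trans = t ; trans∈T = t∈T ; srcOK = refl }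

  rulesFor : (ts : List Tr) → ts ⊆ T → List (Rule L)
  rulesFor []       _    = []
  rulesFor (t ∷ ts) ts⊆T = priorityRule t (ts⊆T (here refl)) ts ∷ rulesFor ts (drop⊆ ts⊆T)

  Sound : Rule L → Set
  Sound r = ∀ xs → xs ∈RC Rule.guard r → xs ∈RC Enabled (Rule.trans r)

  rulesFor-sound : ∀ ts (ts⊆T : ts ⊆ T) → All (λ r → Rule.trans r ∈ ts × Sound r) (rulesFor ts ts⊆T)
  rulesFor-sound []       _    = []
  rulesFor-sound (t ∷ ts) ts⊆T =
    (here refl , λ xs h → proj₁ (∈-∩⁻ xs _ _ h))
    ∷ All.map (λ { (t′∈ts , sound) → there t′∈ts , sound }) (rulesFor-sound ts (drop⊆ ts⊆T))

  -- a later rule at the same state fires only on contents claimed by the later transitions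
  rulesFor-disjoint : ∀ ts (ts⊆T : ts ⊆ T) → AllPairs Disjoint (rulesFor ts ts⊆T)
  rulesFor-disjoint []       _    = []
  rulesFor-disjoint (t ∷ ts) ts⊆T =
    All.map (λ {r} → excludes {r}) (rulesFor-sound ts (drop⊆ ts⊆T)) ∷ rulesFor-disjoint ts (drop⊆ ts⊆T)
    where
    excludes : ∀ {r} → Rule.trans r ∈ ts × Sound r → Disjoint (priorityRule t (ts⊆T (here refl)) ts) r
    excludes {r} (t′∈ts , sound) same xs h h′ =
      ∈-∁⁻ xs _ (proj₂ (∈-∩⁻ xs (Enabled t) _ h))
        (claimed⁺ xs t′∈ts (trans (Rule.srcOK r) (sym same)) (sound xs h′))

  rulesFor-cover : ∀ ts (ts⊆T : ts ⊆ T) xs s → xs ∈RC Claimed ts s →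
    Any (λ r → Rule.state r ≡ s × xs ∈RC Rule.guard r) (rulesFor ts ts⊆T)
  rulesFor-cover (t ∷ ts) ts⊆T xs s claimed with xs ∈? Claimed ts s
  ... | yes laterClaimed = there (rulesFor-cover ts (drop⊆ ts⊆T) xs s laterClaimed)
  ... | no notLater with claimed⁻ xs {t ∷ ts} claimed
  ...   | t′ , there t′∈ts , src≡s , h = ⊥-elim (notLater (claimed⁺ xs t′∈ts src≡s h))
  ...   | _  , here refl   , refl   , h = here (refl , ∈-∩⁺ xs h (∈-∁⁺ xs _ notLater))

module Blocking (L : SGLCS) where
  open SGLCS L using (nS; nC; nM; T)

  Blocked : Fin nS → Contents nC nM → Set
  Blocked s xs = ¬ (Σ (Trans nS nC nM) λ t → t ∈ T × src t ≡ s × ∃ λ xs′ → Effect L (op t) xs xs′)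

  blocked-successor : ∀ {s xs c} → Blocked s xs → Step L ⟨ s , xs , true ⟩ c → c ≡ ⟨ s , xs , false ⟩
  blocked-successor blocked (move t∈T e) = ⊥-elim (blocked (_ , t∈T , refl , _ , e))
  blocked-successor blocked (stuck _)    = refl

module Safety (L : SGLCS) (x : Player) (Q : Config L → Set)
              (regular : IsRegular L Q) (trap : Trap L (opp x) Q) where
  open SGLCS L using (nS; nC; nM; T; owner)
  open Preimage L
  open RuleLists L
  open Blocking L

  R : RegConfRep L
  R = proj₁ regular

  Q⁺ : ∀ {c} → Q c → Config.ch c ∈RC R (Config.st c) (Config.bit c)
  Q⁺ {c} = proj₁ (proj₂ regular c)

  Q⁻ : ∀ {c} → Config.ch c ∈RC R (Config.st c) (Config.bit c) → Q c
  Q⁻ {c} = proj₂ (proj₂ regular c)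

  Enabled : Trans nS nC nM → RegContents nC nM
  Enabled t = preimage (op t) (R (tgt t) false)

  open Prioritised L Enabled

  xMoves : List Tr
  xMoves = filter (λ t → owner (src t) ≟ᴾ x) T

  xMoves⊆T : xMoves ⊆ T
  xMoves⊆T t∈xMoves = proj₁ (∈-filter⁻ (λ t → owner (src t) ≟ᴾ x) {xs = T} t∈xMoves)

  xMove-owned : ∀ {t} → t ∈ xMoves → owner (src t) ≡ x
  xMove-owned t∈xMoves = proj₂ (∈-filter⁻ (λ t → owner (src t) ≟ᴾ x) {xs = T} t∈xMoves)

  rules : List (Rule L)
  rules = rulesFor xMoves xMoves⊆T

  rule-sound : ∀ i → Sound (List.lookup rules i)
  rule-sound i = proj₂ (All.lookup (rulesFor-sound xMoves xMoves⊆T) (∈-lookup i))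

  -- the rules belong to x, and the guard of a receive rule lies in its preimage,
  -- which forces the received message to be at the head
  rules-well-formed : All (λ r → owner (Rule.state r) ≡ x × ReceiveSafe r) rules
  rules-well-formed = All.map (λ {r} → wellFormed r) (rulesFor-sound xMoves xMoves⊆T)
    where
    wellFormed : ∀ r → Rule.trans r ∈ xMoves × Sound r → owner (Rule.state r) ≡ x × ReceiveSafe r
    wellFormed r (t∈xMoves , sound) =
      subst (λ s → owner s ≡ x) (Rule.srcOK r) (xMove-owned t∈xMoves) ,
      λ c m op≡recv xs h →
        ∈-preimage-recv xs (subst (λ o → xs ∈RC preimage o (R (tgt (Rule.trans r)) false)) op≡recv (sound xs h))

  strategy : RegStrategy L x
  strategy = toRegStrategy x rules rules-well-formed (rulesFor-disjoint xMoves xMoves⊆T)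

  successor-claimed : ∀ {s xs c} → owner s ≡ x → ¬ Blocked s xs →
    Step L ⟨ s , xs , true ⟩ c → Q c → xs ∈RC Claimed xMoves s
  successor-claimed {xs = xs} owned _ (move t∈T e) qc =
    claimed⁺ xs (∈-filter⁺ (λ t → owner (src t) ≟ᴾ x) t∈T owned) refl (∈-preimage⁺ xs e (Q⁺ qc))
  successor-claimed _ notBlocked (stuck blocked) _ = ⊥-elim (notBlocked blocked)

  rule-fires : ∀ i {c} → Config.st c ≡ Rule.state (List.lookup rules i) → Config.bit c ≡ true →
    Config.ch c ∈RC Rule.guard (List.lookup rules i) → Σ (Config L) λ c′ → FHat L strategy c c′ × Q c′
  rule-fires i {c} st≡ bit≡ guarded with ∈-preimage-effect (Config.ch c) (rule-sound i (Config.ch c) guarded)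
  ... | xs′ , e , xs′∈R = _ , (i , st≡ , bit≡ , guarded , xs′ , e , refl) , Q⁻ xs′∈R

  Follows : Config L → Config L → Set
  Follows c c′ = ∀ c″ → OwnedBy L x c → FHat L strategy c c″ → c′ ≡ c″

  controlled-step : ∀ {s xs c′} → owner s ≡ x → ¬ Blocked s xs → Q ⟨ s , xs , true ⟩ →
    Follows ⟨ s , xs , true ⟩ c′ → Q c′
  controlled-step {s} {xs} owned notBlocked q follows with proj₁ (proj₁ trap) _ q
  ... | c , step , qc with rulesFor-cover xMoves xMoves⊆T xs s (successor-claimed owned notBlocked step qc)
  ... | covered with lookup-index covered
  ... | state≡s , guarded with rule-fires (Any.index covered) (sym state≡s) refl guarded
  ... | c″ , fired , q″ = subst Q (sym (follows c″ (refl , owned) fired)) q″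

  -- Q is invariant under every step that follows the strategy: random steps and
  -- moves of the opponent by the trap property, idle steps and moves of x
  -- because Q contains a successor of each of its configurations
  step-preserves : ∀ {c c′} → Q c → Step L c c′ → Follows c c′ → Q c′
  step-preserves q step@(lose _) _ = proj₂ (proj₁ trap) _ _ q refl step
  step-preserves q (stuck blocked) _ with proj₁ (proj₁ trap) _ q
  ... | c″ , step″ , q″ = subst Q (blocked-successor blocked step″) q″
  step-preserves q step@(move {t} t∈T e) follows with player-dichotomy (owner (src t)) x
  ... | inj₁ owned = controlled-step owned (λ blocked → blocked (t , t∈T , refl , _ , e)) q follows
  ... | inj₂ opponent = proj₂ trap _ _ q (refl , opponent) step

  stays-in-Q : ∀ {s} → Q s → (r : Run L s) → ConsistentWithHat L x strategy r → ∀ i → Q (Run.ρ r i)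
  stays-in-Q qs r consistent zero    = subst Q (sym (Run.start r)) qs
  stays-in-Q qs r consistent (suc i) =
    step-preserves (stays-in-Q qs r consistent i) (Run.steps r i) (consistent i)

lemma5p15 : (L : SGLCS) (x : Player) (Q : Config L → Set) →
    IsRegular L Q → Trap L (opp x) Q →
    Σ (RegStrategy L x) λ f →
      ∀ s → Q s → (g : Strategy L (opp x)) (r : Run L s) →
      ConsistentWithHat L x f r → ConsistentWith L (opp x) g r →
      (i : ℕ) → Q (Run.ρ r i)
lemma5p15 L x Q regular trap = strategy , λ _ qs _ r consistent _ → stays-in-Q qs r consistent
  where open Safety L x Q regular trap
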